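{- Let $n\ge 1$, $0\le m\le n$ and $0\le k\le n$. Then $v_{n,m,k}=v_{n,n-m,n-k}$.
   Context: A Dyck path of semilength $n\ge 0$ is a lattice path in $\mathbb{Z}\times\mathbb{Z}$ from $(0,0)$ to $(2n,0)$ using up steps $U=(1,1)$ and down steps $D=(1,-1)$; it is allowed to go below the $x$-axis. Write it as a word $P_1P_2\cdots P_{2n}$ over $\{U,D\}$. An up step is under the $x$-axis if it goes from height $-h$ to height $-h+1$ for some $h\ge 1$. A Dyck path is $(n,m)$-flawed if it has semilength $n$ and exactly $m$ up steps under the $x$-axis. A valley is a position $i$ with $P_iP_{i+1}=DU$. Let $v_{n,m,k}$ be the number of $(n,m)$-flawed paths with exactly $k$ valleys. -}

module Defs where

open import Data.Nat using (ℕ; zero; suc; _+_; _*_)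
open import Data.Integer as ℤ using (ℤ; +_; -[1+_]; 0ℤ)
open import Data.List using (List; []; _∷_; length; filter; map; concatMap)
open import Relation.Nullary.Decidable using (_×-dec_)
open import Relation.Binary.PropositionalEquality using (_≡_)
import Data.Nat.Properties as ℕP
import Data.Integer.Properties as ℤP

-- Steps: U = (1,1), D = (1,-1)
data Step : Set where
  U D : Step

Path : Set
Path = List Step

words : ℕ → List Path
words zero    = [] ∷ []
words (suc ℓ) = concatMap (λ w → (U ∷ w) ∷ (D ∷ w) ∷ []) (words ℓ)

endHeight : ℤ → Path → ℤ
endHeight h []      = h
endHeight h (U ∷ p) = endHeight (ℤ.suc h) p
endHeight h (D ∷ p) = endHeight (ℤ.pred h) p

-- number of up steps under the x-axis, i.e. up steps from height -h to -h+1
-- with h ≥ 1 (equivalently, starting at a negative height), when the path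
-- starts at height h
underUps : ℤ → Path → ℕ
underUps h []      = 0
underUps h (U ∷ p) with h
... | -[1+ _ ] = suc (underUps (ℤ.suc h) p)
... | + _      = underUps (ℤ.suc h) p
underUps h (D ∷ p) = underUps (ℤ.pred h) p

valleys : Path → ℕ
valleys []            = 0
valleys (D ∷ U ∷ p)   = suc (valleys (U ∷ p))
valleys (_ ∷ p)       = valleys p

-- v n m k : the number of (n,m)-flawed paths with exactly k valleys
-- (words of length 2n are enumerated, so length holds automatically)
v : ℕ → ℕ → ℕ → ℕ
v n m k = length (filter (λ P → (endHeight 0ℤ P ℤP.≟ 0ℤ) ×-dec (underUps 0ℤ P ℕP.≟ m) ×-dec (valleys P ℕP.≟ k))
                         (words (2 * n)))

-- A closed path splits into maximal excursions, alternately above and below the axis;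
-- each is the Dyck path of a nonempty binary tree, reflected in the axis when it lies
-- below.  ψ moves every excursion to the other side and replaces its tree by the mirror
-- image.  An excursion of size s has no up steps under the axis when above and s of them
-- when below, so ψ turns m into n − m.  Valleys add up over excursions; above the axis a
-- tree has s − (nodes with a leaf as right child) valleys, below it has (nodes with a leaf
-- as left child) valleys, and mirroring exchanges these two leaf counts, so ψ turns k
-- into n − k.  The excursions are recovered by a right-to-left shift–reduce parser.
module Submission where

open import Defs
open import Data.Nat using (ℕ; zero; suc; _+_; _*_; _≤_; _∸_; s≤s)
open import Data.Nat.Properties as ℕP
  using (+-suc; +-assoc; +-comm; +-identityʳ; +-cancelʳ-≡; *-cancelˡ-≡; m+n∸m≡n; m∸[m∸n]≡n)
open import Algebra.Properties.CommutativeSemigroup ℕP.+-commutativeSemigroup using (interchange)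
open import Data.Integer as ℤ using (ℤ; -[1+_]; 0ℤ)
import Data.Integer.Properties as ℤP
open import Data.List using (List; []; _∷_; [_]; _++_; map; foldr; length; filter; concatMap; head)
open import Data.Nat.ListAction using (sum)
open import Data.List.Properties using (++-assoc; ++-identityʳ; foldr-++; length-++; length-map; map-∘; map-cong; map-id)
open import Data.Maybe using (just)
open import Data.Product using (_×_; _,_; ∃-syntax)
open import Data.Sum using (_⊎_; inj₁; inj₂)
open import Data.Empty using (⊥-elim)
open import Relation.Binary.PropositionalEquality
  using (_≡_; _≢_; refl; sym; trans; cong; cong₂; subst; subst₂; module ≡-Reasoning)
open import Relation.Nullary.Decidable using (_×-dec_)
open import Relation.Unary using (Decidable)
open import Data.List.Relation.Unary.All as All using (All; []; _∷_)
open import Data.List.Relation.Unary.All.Properties using (¬Any⇒All¬)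
open import Data.List.Relation.Unary.Any using (here; there)
open import Data.List.Membership.Propositional using (_∈_; _∉_)
open import Data.List.Membership.Propositional.Properties using (∈-map⁺; ∈-map⁻; ∈-filter⁺; ∈-filter⁻)
open import Data.List.Membership.Propositional.Properties.WithK using (unique∧set⇒bag)
open import Data.List.Relation.Unary.Unique.Propositional using (Unique; []; _∷_)
import Data.List.Relation.Unary.Unique.Propositional.Properties as Unique
open import Data.List.Relation.Binary.BagAndSetEquality using (∼bag⇒↭)
open import Data.List.Relation.Binary.Permutation.Propositional.Properties using (↭-length)
open import Function.Bundles using (mk⇔)
open import Data.Nat.Solver using (module +-*-Solver)

open ≡-Reasoning

-- Counting by an involution

length-filter-involution :
  ∀ {A : Set} {P Q : A → Set} (P? : Decidable P) (Q? : Decidable Q) xs (f : A → A) →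
  Unique xs → (∀ x → f (f x) ≡ x) → (∀ {x} → x ∈ xs → f x ∈ xs) →
  (∀ {x} → x ∈ xs → P x → Q (f x)) → (∀ {x} → x ∈ xs → Q x → P (f x)) →
  length (filter P? xs) ≡ length (filter Q? xs)
length-filter-involution P? Q? xs f xs! f-inv f-closed P⇒Q Q⇒P =
  trans (sym (length-map f (filter P? xs)))
        (↭-length (∼bag⇒↭ (unique∧set⇒bag fP! Q! (mk⇔ to from))))
  where
  f-injective : ∀ {x y} → f x ≡ f y → x ≡ y
  f-injective {x} {y} fx≡fy = trans (sym (f-inv x)) (trans (cong f fx≡fy) (f-inv y))
  fP! : Unique (map f (filter P? xs))
  fP! = Unique.map⁺ f-injective (Unique.filter⁺ P? xs!)
  Q! : Unique (filter Q? xs)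
  Q! = Unique.filter⁺ Q? xs!
  to : ∀ {y} → y ∈ map f (filter P? xs) → y ∈ filter Q? xs
  to y∈ with ∈-map⁻ f y∈
  ... | x , x∈ , refl with ∈-filter⁻ P? x∈
  ... | x∈xs , Px = ∈-filter⁺ Q? (f-closed x∈xs) (P⇒Q x∈xs Px)
  from : ∀ {y} → y ∈ filter Q? xs → y ∈ map f (filter P? xs)
  from {y} y∈ with ∈-filter⁻ Q? y∈
  ... | y∈xs , Qy = subst (_∈ map f (filter P? xs)) (f-inv y)
                          (∈-map⁺ f (∈-filter⁺ P? (f-closed y∈xs) (Q⇒P y∈xs Qy)))

extend : Path → List Path
extend w = (U ∷ w) ∷ (D ∷ w) ∷ []

∈-extend⁺ : ∀ x {w ws} → w ∈ ws → (x ∷ w) ∈ concatMap extend ws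
∈-extend⁺ U (here refl) = here refl
∈-extend⁺ D (here refl) = there (here refl)
∈-extend⁺ x (there w∈) = there (there (∈-extend⁺ x w∈))

∈-extend⁻ : ∀ {x w} ws → (x ∷ w) ∈ concatMap extend ws → w ∈ ws
∈-extend⁻ (v ∷ vs) (here refl)         = here refl
∈-extend⁻ (v ∷ vs) (there (here refl)) = here refl
∈-extend⁻ (v ∷ vs) (there (there w∈))  = there (∈-extend⁻ vs w∈)

[]∉extend : ∀ ws → [] ∉ concatMap extend ws
[]∉extend (v ∷ vs) (there (there []∈)) = []∉extend vs []∈

∈-words⁺ : ∀ w → w ∈ words (length w)
∈-words⁺ []      = here refl
∈-words⁺ (x ∷ w) = ∈-extend⁺ x (∈-words⁺ w)

∈-words⁻ : ∀ ℓ {w} → w ∈ words ℓ → length w ≡ ℓ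
∈-words⁻ zero    (here refl) = refl
∈-words⁻ (suc ℓ) {[]}    []∈ = ⊥-elim ([]∉extend (words ℓ) []∈)
∈-words⁻ (suc ℓ) {x ∷ w} w∈  = cong suc (∈-words⁻ ℓ (∈-extend⁻ (words ℓ) w∈))

extend-unique : ∀ {ws} → Unique ws → Unique (concatMap extend ws)
extend-unique []                    = []
extend-unique {w ∷ ws} (w∉ws ∷ ws!) =
  ¬Any⇒All¬ _ (λ { (there U∷w∈) → x∷w∉ U∷w∈ }) ∷ ¬Any⇒All¬ _ x∷w∉ ∷ extend-unique ws!
  where
  x∷w∉ : ∀ {x} → (x ∷ w) ∉ concatMap extend ws
  x∷w∉ x∷w∈ = All.lookup w∉ws (∈-extend⁻ ws x∷w∈) refl

words-unique : ∀ ℓ → Unique (words ℓ)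
words-unique zero    = [] ∷ []
words-unique (suc ℓ) = extend-unique (words-unique ℓ)

endHeight-++ : ∀ h p q → endHeight h (p ++ q) ≡ endHeight (endHeight h p) q
endHeight-++ h []      q = refl
endHeight-++ h (U ∷ p) q = endHeight-++ (ℤ.suc h) p q
endHeight-++ h (D ∷ p) q = endHeight-++ (ℤ.pred h) p q

underUps-++ : ∀ h p q → underUps h (p ++ q) ≡ underUps h p + underUps (endHeight h p) q
underUps-++ h        []      q = refl
underUps-++ (ℤ.+ n)    (U ∷ p) q = underUps-++ (ℤ.suc (ℤ.+ n)) p q
underUps-++ -[1+ n ] (U ∷ p) q = cong suc (underUps-++ (ℤ.suc -[1+ n ]) p q)
underUps-++ h        (D ∷ p) q = underUps-++ (ℤ.pred h) p q

opposite : Step → Step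
opposite U = D
opposite D = U

opposite-involutive : ∀ x → opposite (opposite x) ≡ x
opposite-involutive U = refl
opposite-involutive D = refl

move : Step → ℤ → ℤ
move U = ℤ.suc
move D = ℤ.pred

endHeight-∷ : ∀ x h p → endHeight h (x ∷ p) ≡ endHeight (move x h) p
endHeight-∷ U h p = refl
endHeight-∷ D h p = refl

move-opposite : ∀ x h → move (opposite x) (move x h) ≡ h
move-opposite U h = ℤP.pred-suc h
move-opposite D h = ℤP.suc-pred h

-- Binary trees and their Dyck paths

data Tree : Set where
  leaf : Tree
  node : Tree → Tree → Tree

data IsNode : Tree → Set where
  isNode : ∀ {l r} → IsNode (node l r)

size : Tree → ℕ
size leaf       = 0
size (node l r) = suc (size l + size r)

mirror : Tree → Tree
mirror leaf       = leaf
mirror (node l r) = node (mirror r) (mirror l)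

leftLeaves : Tree → ℕ
leftLeaves leaf                = 0
leftLeaves (node leaf r)       = suc (leftLeaves r)
leftLeaves (node (node a b) r) = leftLeaves (node a b) + leftLeaves r

rightLeaves : Tree → ℕ
rightLeaves leaf                = 0
rightLeaves (node l leaf)       = suc (rightLeaves l)
rightLeaves (node l (node a b)) = rightLeaves l + rightLeaves (node a b)

mirror-nodes : ∀ {bs} → All IsNode bs → All IsNode (map mirror bs)
mirror-nodes []              = []
mirror-nodes (isNode ∷ rest) = isNode ∷ mirror-nodes rest

mirror-involutive : ∀ t → mirror (mirror t) ≡ t
mirror-involutive leaf       = refl
mirror-involutive (node l r) = cong₂ node (mirror-involutive l) (mirror-involutive r)

map-mirror-involutive : ∀ bs → map mirror (map mirror bs) ≡ bs
map-mirror-involutive bs = trans (sym (map-∘ bs)) (trans (map-cong mirror-involutive bs) (map-id bs))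

size-mirror : ∀ t → size (mirror t) ≡ size t
size-mirror leaf       = refl
size-mirror (node l r) = cong suc (trans (cong₂ _+_ (size-mirror r) (size-mirror l)) (+-comm (size r) (size l)))

leftLeaves-mirror : ∀ t → leftLeaves (mirror t) ≡ rightLeaves t
leftLeaves-mirror leaf                = refl
leftLeaves-mirror (node l leaf)       = cong suc (leftLeaves-mirror l)
leftLeaves-mirror (node l (node a b)) =
  trans (cong₂ _+_ (leftLeaves-mirror (node a b)) (leftLeaves-mirror l)) (+-comm _ (rightLeaves l))

rightLeaves-mirror : ∀ t → rightLeaves (mirror t) ≡ leftLeaves t
rightLeaves-mirror t = trans (sym (leftLeaves-mirror (mirror t))) (cong leftLeaves (mirror-involutive t))

-- dyck U t is the usual Dyck path of t (node l r ↦ U (l) D (r)); dyck D t is its reflection in the axis.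
dyck : Step → Tree → Path
dyck o leaf       = []
dyck o (node l r) = o ∷ dyck o l ++ opposite o ∷ dyck o r

length-dyck : ∀ o t → length (dyck o t) ≡ 2 * size t
length-dyck o leaf       = refl
length-dyck o (node l r) = begin
  suc (length (dyck o l ++ opposite o ∷ dyck o r))    ≡⟨ cong suc (length-++ (dyck o l)) ⟩
  suc (length (dyck o l) + suc (length (dyck o r)))   ≡⟨ cong₂ (λ a b → suc (a + suc b)) (length-dyck o l) (length-dyck o r) ⟩
  suc (2 * size l + suc (2 * size r))                 ≡⟨ solve 2 (λ a b → con 1 :+ (con 2 :* a :+ (con 1 :+ con 2 :* b))
                                                                   := con 2 :* (con 1 :+ (a :+ b))) refl (size l) (size r) ⟩
  2 * suc (size l + size r) ∎
  where open +-*-Solver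

endHeight-dyck : ∀ o h t → endHeight h (dyck o t) ≡ h
endHeight-dyck o h leaf       = refl
endHeight-dyck o h (node l r) = begin
  endHeight h (o ∷ dyck o l ++ opposite o ∷ dyck o r)                         ≡⟨ endHeight-∷ o h _ ⟩
  endHeight (move o h) (dyck o l ++ opposite o ∷ dyck o r)                     ≡⟨ endHeight-++ (move o h) (dyck o l) _ ⟩
  endHeight (endHeight (move o h) (dyck o l)) (opposite o ∷ dyck o r)          ≡⟨ cong (λ g → endHeight g (opposite o ∷ dyck o r)) (endHeight-dyck o (move o h) l) ⟩
  endHeight (move o h) (opposite o ∷ dyck o r)                                 ≡⟨ endHeight-∷ (opposite o) (move o h) _ ⟩
  endHeight (move (opposite o) (move o h)) (dyck o r)                          ≡⟨ cong (λ g → endHeight g (dyck o r)) (move-opposite o h) ⟩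
  endHeight h (dyck o r)                                                       ≡⟨ endHeight-dyck o h r ⟩
  h ∎

underUps-dyck-U : ∀ n t → underUps (ℤ.+ n) (dyck U t) ≡ 0
underUps-dyck-U n leaf       = refl
underUps-dyck-U n (node l r) = begin
  underUps (ℤ.+ suc n) (dyck U l ++ D ∷ dyck U r)                                       ≡⟨ underUps-++ (ℤ.+ suc n) (dyck U l) _ ⟩
  underUps (ℤ.+ suc n) (dyck U l) + underUps (endHeight (ℤ.+ suc n) (dyck U l)) (D ∷ dyck U r)
    ≡⟨ cong₂ (λ a g → a + underUps g (D ∷ dyck U r)) (underUps-dyck-U (suc n) l) (endHeight-dyck U (ℤ.+ suc n) l) ⟩
  underUps (ℤ.pred (ℤ.+ suc n)) (dyck U r)                                               ≡⟨ cong (λ g → underUps g (dyck U r)) (ℤP.pred-suc (ℤ.+ n)) ⟩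
  underUps (ℤ.+ n) (dyck U r)                                                            ≡⟨ underUps-dyck-U n r ⟩
  0 ∎

pred-nonpositive : ∀ {h} → h ℤ.≤ 0ℤ → ∃[ j ] ℤ.pred h ≡ -[1+ j ]
pred-nonpositive { -[1+ j ]} ℤ.-≤+ = suc j , refl
pred-nonpositive {ℤ.+ 0}     _     = 0 , refl
pred-nonpositive {ℤ.+ suc _} (ℤ.+≤+ ())

underUps-dyck-D : ∀ t {h} → h ℤ.≤ 0ℤ → underUps h (dyck D t) ≡ size t
underUps-dyck-D leaf       h≤0 = refl
underUps-dyck-D (node l r) {h} h≤0 with pred-nonpositive h≤0
... | j , pred-h = begin
  underUps (ℤ.pred h) (dyck D l ++ U ∷ dyck D r)               ≡⟨ cong (λ g → underUps g (dyck D l ++ U ∷ dyck D r)) pred-h ⟩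
  underUps -[1+ j ] (dyck D l ++ U ∷ dyck D r)                 ≡⟨ underUps-++ -[1+ j ] (dyck D l) _ ⟩
  underUps -[1+ j ] (dyck D l) + underUps (endHeight -[1+ j ] (dyck D l)) (U ∷ dyck D r)
    ≡⟨ cong₂ (λ a g → a + underUps g (U ∷ dyck D r)) (underUps-dyck-D l ℤ.-≤+) (endHeight-dyck D -[1+ j ] l) ⟩
  size l + suc (underUps (ℤ.suc -[1+ j ]) (dyck D r))           ≡⟨ cong (λ g → size l + suc (underUps g (dyck D r))) suc-pred-h ⟩
  size l + suc (underUps h (dyck D r))                          ≡⟨ cong (λ a → size l + suc a) (underUps-dyck-D r h≤0) ⟩
  size l + suc (size r)                                         ≡⟨ +-suc (size l) (size r) ⟩
  suc (size l + size r) ∎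
  where
  suc-pred-h : ℤ.suc -[1+ j ] ≡ h
  suc-pred-h = trans (cong ℤ.suc (sym pred-h)) (ℤP.suc-pred h)

valleys-D∷ : ∀ q → head q ≢ just U → valleys (D ∷ q) ≡ valleys q
valleys-D∷ []      _    = refl
valleys-D∷ (U ∷ q) ¬U∷q = ⊥-elim (¬U∷q refl)
valleys-D∷ (D ∷ q) _    = refl

valleys-dyck-U-++ : ∀ t q → head q ≢ just U → valleys (dyck U t ++ q) + rightLeaves t ≡ size t + valleys q
valleys-dyck-U-++ leaf q _ = +-identityʳ (valleys q)
valleys-dyck-U-++ (node l leaf) q ¬U∷q = begin
  valleys ((dyck U l ++ [ D ]) ++ q) + suc (rightLeaves l)     ≡⟨ cong (λ p → valleys p + _) (++-assoc (dyck U l) [ D ] q) ⟩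
  valleys (dyck U l ++ D ∷ q) + suc (rightLeaves l)            ≡⟨ +-suc _ (rightLeaves l) ⟩
  suc (valleys (dyck U l ++ D ∷ q) + rightLeaves l)            ≡⟨ cong suc (valleys-dyck-U-++ l (D ∷ q) λ ()) ⟩
  suc (size l + valleys (D ∷ q))                               ≡⟨ cong (λ a → suc (size l + a)) (valleys-D∷ q ¬U∷q) ⟩
  suc (size l + valleys q)                                     ≡⟨ cong (λ a → suc (a + valleys q)) (sym (+-identityʳ (size l))) ⟩
  suc (size l + 0) + valleys q ∎
valleys-dyck-U-++ (node l r@(node _ _)) q ¬U∷q = begin
  valleys ((dyck U l ++ D ∷ dyck U r) ++ q) + (rightLeaves l + rightLeaves r)
    ≡⟨ cong (λ p → valleys p + _) (++-assoc (dyck U l) (D ∷ dyck U r) q) ⟩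
  valleys (dyck U l ++ D ∷ (dyck U r ++ q)) + (rightLeaves l + rightLeaves r)
    ≡⟨ sym (+-assoc _ (rightLeaves l) (rightLeaves r)) ⟩
  valleys (dyck U l ++ D ∷ (dyck U r ++ q)) + rightLeaves l + rightLeaves r
    ≡⟨ cong (_+ rightLeaves r) (valleys-dyck-U-++ l (D ∷ (dyck U r ++ q)) λ ()) ⟩
  size l + suc (valleys (dyck U r ++ q)) + rightLeaves r      ≡⟨ +-assoc (size l) _ (rightLeaves r) ⟩
  size l + suc (valleys (dyck U r ++ q) + rightLeaves r)      ≡⟨ cong (λ a → size l + suc a) (valleys-dyck-U-++ r q ¬U∷q) ⟩
  size l + suc (size r + valleys q)                           ≡⟨ +-suc (size l) _ ⟩
  suc (size l + (size r + valleys q))                         ≡⟨ cong suc (sym (+-assoc (size l) (size r) (valleys q))) ⟩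
  suc (size l + size r) + valleys q ∎

valleys-dyck-D-++ : ∀ t q → valleys (dyck D t ++ q) ≡ leftLeaves t + valleys q
valleys-dyck-D-++ leaf                q = refl
valleys-dyck-D-++ (node leaf r)       q = cong suc (valleys-dyck-D-++ r q)
valleys-dyck-D-++ (node l@(node _ _) r) q = begin
  valleys ((dyck D l ++ U ∷ dyck D r) ++ q)   ≡⟨ cong valleys (++-assoc (dyck D l) (U ∷ dyck D r) q) ⟩
  valleys (dyck D l ++ U ∷ (dyck D r ++ q))   ≡⟨ valleys-dyck-D-++ l (U ∷ (dyck D r ++ q)) ⟩
  leftLeaves l + valleys (dyck D r ++ q)      ≡⟨ cong (leftLeaves l +_) (valleys-dyck-D-++ r q) ⟩
  leftLeaves l + (leftLeaves r + valleys q)   ≡⟨ sym (+-assoc (leftLeaves l) _ _) ⟩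
  leftLeaves l + leftLeaves r + valleys q ∎

valleys-dyck-U : ∀ t → valleys (dyck U t) + rightLeaves t ≡ size t
valleys-dyck-U t = begin
  valleys (dyck U t) + rightLeaves t        ≡⟨ cong (λ p → valleys p + rightLeaves t) (sym (++-identityʳ (dyck U t))) ⟩
  valleys (dyck U t ++ []) + rightLeaves t  ≡⟨ valleys-dyck-U-++ t [] (λ ()) ⟩
  size t + 0                                ≡⟨ +-identityʳ (size t) ⟩
  size t ∎

valleys-dyck-D : ∀ t → valleys (dyck D t) ≡ leftLeaves t
valleys-dyck-D t = begin
  valleys (dyck D t)         ≡⟨ cong valleys (sym (++-identityʳ (dyck D t))) ⟩
  valleys (dyck D t ++ [])   ≡⟨ valleys-dyck-D-++ t [] ⟩
  leftLeaves t + 0           ≡⟨ +-identityʳ (leftLeaves t) ⟩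
  leftLeaves t ∎

valleys-dyck-++ : ∀ o t q → head q ≢ just o → valleys (dyck o t ++ q) ≡ valleys (dyck o t) + valleys q
valleys-dyck-++ U t q ¬U∷q = +-cancelʳ-≡ (rightLeaves t) _ _ (begin
  valleys (dyck U t ++ q) + rightLeaves t       ≡⟨ valleys-dyck-U-++ t q ¬U∷q ⟩
  size t + valleys q                            ≡⟨ cong (_+ valleys q) (sym (valleys-dyck-U t)) ⟩
  valleys (dyck U t) + rightLeaves t + valleys q  ≡⟨ +-assoc (valleys (dyck U t)) _ _ ⟩
  valleys (dyck U t) + (rightLeaves t + valleys q)  ≡⟨ cong (valleys (dyck U t) +_) (+-comm (rightLeaves t) _) ⟩
  valleys (dyck U t) + (valleys q + rightLeaves t)  ≡⟨ sym (+-assoc (valleys (dyck U t)) _ _) ⟩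
  valleys (dyck U t) + valleys q + rightLeaves t ∎)
valleys-dyck-++ D t q _ = trans (valleys-dyck-D-++ t q) (cong (_+ valleys q) (sym (valleys-dyck-D t)))

underUps-dyck-complement : ∀ o t → underUps 0ℤ (dyck o t) + underUps 0ℤ (dyck (opposite o) (mirror t)) ≡ size t
underUps-dyck-complement U t =
  cong₂ _+_ (underUps-dyck-U 0 t) (trans (underUps-dyck-D (mirror t) (ℤ.+≤+ ℕP.≤-refl)) (size-mirror t))
underUps-dyck-complement D t =
  trans (cong₂ _+_ (underUps-dyck-D t (ℤ.+≤+ ℕP.≤-refl)) (underUps-dyck-U 0 (mirror t))) (+-identityʳ (size t))

valleys-dyck-complement : ∀ o t → valleys (dyck o t) + valleys (dyck (opposite o) (mirror t)) ≡ size t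
valleys-dyck-complement U t = begin
  valleys (dyck U t) + valleys (dyck D (mirror t))  ≡⟨ cong (valleys (dyck U t) +_) (valleys-dyck-D (mirror t)) ⟩
  valleys (dyck U t) + leftLeaves (mirror t)        ≡⟨ cong (valleys (dyck U t) +_) (leftLeaves-mirror t) ⟩
  valleys (dyck U t) + rightLeaves t                ≡⟨ valleys-dyck-U t ⟩
  size t ∎
valleys-dyck-complement D t = begin
  valleys (dyck D t) + valleys (dyck U (mirror t))  ≡⟨ cong (_+ valleys (dyck U (mirror t))) (valleys-dyck-D t) ⟩
  leftLeaves t + valleys (dyck U (mirror t))        ≡⟨ +-comm (leftLeaves t) _ ⟩
  valleys (dyck U (mirror t)) + leftLeaves t        ≡⟨ cong (valleys (dyck U (mirror t)) +_) (sym (rightLeaves-mirror t)) ⟩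
  valleys (dyck U (mirror t)) + rightLeaves (mirror t)  ≡⟨ valleys-dyck-U (mirror t) ⟩
  size (mirror t)                                   ≡⟨ size-mirror t ⟩
  size t ∎

-- Alternating sequences of excursions

excursions : Step → List Tree → Path
excursions o []       = []
excursions o (b ∷ bs) = dyck o b ++ excursions (opposite o) bs

blockwise : (Path → ℕ) → Step → List Tree → ℕ
blockwise stat o []       = 0
blockwise stat o (b ∷ bs) = stat (dyck o b) + blockwise stat (opposite o) bs

sizes : List Tree → ℕ
sizes bs = sum (map size bs)

sizes-mirror : ∀ bs → sizes (map mirror bs) ≡ sizes bs
sizes-mirror bs = cong sum (trans (sym (map-∘ bs)) (map-cong size-mirror bs))

length-excursions : ∀ o bs → length (excursions o bs) ≡ 2 * sizes bs
length-excursions o []       = refl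
length-excursions o (b ∷ bs) = begin
  length (dyck o b ++ excursions (opposite o) bs)            ≡⟨ length-++ (dyck o b) ⟩
  length (dyck o b) + length (excursions (opposite o) bs)    ≡⟨ cong₂ _+_ (length-dyck o b) (length-excursions (opposite o) bs) ⟩
  2 * size b + 2 * sizes bs                                  ≡⟨ sym (ℕP.*-distribˡ-+ 2 (size b) (sizes bs)) ⟩
  2 * sizes (b ∷ bs) ∎

endHeight-excursions : ∀ o h bs → endHeight h (excursions o bs) ≡ h
endHeight-excursions o h []       = refl
endHeight-excursions o h (b ∷ bs) = begin
  endHeight h (dyck o b ++ excursions (opposite o) bs)               ≡⟨ endHeight-++ h (dyck o b) _ ⟩
  endHeight (endHeight h (dyck o b)) (excursions (opposite o) bs)    ≡⟨ cong (λ g → endHeight g (excursions (opposite o) bs)) (endHeight-dyck o h b) ⟩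
  endHeight h (excursions (opposite o) bs)                           ≡⟨ endHeight-excursions (opposite o) h bs ⟩
  h ∎

underUps-excursions : ∀ o bs → underUps 0ℤ (excursions o bs) ≡ blockwise (underUps 0ℤ) o bs
underUps-excursions o []       = refl
underUps-excursions o (b ∷ bs) = begin
  underUps 0ℤ (dyck o b ++ excursions (opposite o) bs)
    ≡⟨ underUps-++ 0ℤ (dyck o b) _ ⟩
  underUps 0ℤ (dyck o b) + underUps (endHeight 0ℤ (dyck o b)) (excursions (opposite o) bs)
    ≡⟨ cong (λ g → underUps 0ℤ (dyck o b) + underUps g (excursions (opposite o) bs)) (endHeight-dyck o 0ℤ b) ⟩
  underUps 0ℤ (dyck o b) + underUps 0ℤ (excursions (opposite o) bs)
    ≡⟨ cong (underUps 0ℤ (dyck o b) +_) (underUps-excursions (opposite o) bs) ⟩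
  blockwise (underUps 0ℤ) o (b ∷ bs) ∎

head-excursions : ∀ o bs → All IsNode bs → head (excursions (opposite o) bs) ≢ just o
head-excursions U []       _           ()
head-excursions D []       _           ()
head-excursions U (_ ∷ _) (isNode ∷ _) ()
head-excursions D (_ ∷ _) (isNode ∷ _) ()

valleys-excursions : ∀ o bs → All IsNode bs → valleys (excursions o bs) ≡ blockwise valleys o bs
valleys-excursions o []       []               = refl
valleys-excursions o (b ∷ bs) (_ ∷ bs-nodes) = begin
  valleys (dyck o b ++ excursions (opposite o) bs)          ≡⟨ valleys-dyck-++ o b _ (head-excursions o bs bs-nodes) ⟩
  valleys (dyck o b) + valleys (excursions (opposite o) bs) ≡⟨ cong (valleys (dyck o b) +_) (valleys-excursions (opposite o) bs bs-nodes) ⟩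
  blockwise valleys o (b ∷ bs) ∎

record Complemented (stat : Path → ℕ) : Set where
  field
    additive   : ∀ o bs → All IsNode bs → stat (excursions o bs) ≡ blockwise stat o bs
    complement : ∀ o t → stat (dyck o t) + stat (dyck (opposite o) (mirror t)) ≡ size t

underUps-complemented : Complemented (underUps 0ℤ)
underUps-complemented = record
  { additive   = λ o bs _ → underUps-excursions o bs
  ; complement = underUps-dyck-complement
  }

valleys-complemented : Complemented valleys
valleys-complemented = record
  { additive   = valleys-excursions
  ; complement = valleys-dyck-complement
  }

blockwise-mirror : ∀ {stat} → Complemented stat → ∀ o bs →
                   blockwise stat o bs + blockwise stat (opposite o) (map mirror bs) ≡ sizes bs
blockwise-mirror c o []       = refl
blockwise-mirror {stat} c o (b ∷ bs) = begin
  (stat (dyck o b) + blockwise stat (opposite o) bs) + (stat (dyck (opposite o) (mirror b)) + blockwise stat (opposite (opposite o)) (map mirror bs))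
    ≡⟨ interchange (stat (dyck o b)) _ _ _ ⟩
  (stat (dyck o b) + stat (dyck (opposite o) (mirror b))) + (blockwise stat (opposite o) bs + blockwise stat (opposite (opposite o)) (map mirror bs))
    ≡⟨ cong₂ _+_ (Complemented.complement c o b) (blockwise-mirror c (opposite o) bs) ⟩
  sizes (b ∷ bs) ∎

-- Parsing a path into excursions

-- In state o t rs bs the suffix read so far is
-- dyck o t, then for each pending r a closing step followed by dyck o r, then the
-- finished excursions bs, which start on the other side of the axis.  An opening step
-- with nothing pending ends the current excursion.
data State : Set where
  state : Step → Tree → List Tree → List Tree → State

withPending : Step → List Tree → Path → Path
withPending o []       k = k
withPending o (r ∷ rs) k = opposite o ∷ dyck o r ++ withPending o rs k

serialise : State → Path
serialise (state o t rs bs) = dyck o t ++ withPending o rs (excursions (opposite o) bs)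

reduce : Step → Tree → List Tree → List Tree → State
reduce o t          (r ∷ rs) bs = state o (node t r) rs bs
reduce o leaf       []       bs = state (opposite o) leaf [ leaf ] bs
reduce o (node l r) []       bs = state (opposite o) leaf [ leaf ] (node l r ∷ bs)

step : Step → State → State
step U (state U t rs bs) = reduce U t rs bs
step D (state D t rs bs) = reduce D t rs bs
step U (state D t rs bs) = state D leaf (t ∷ rs) bs
step D (state U t rs bs) = state U leaf (t ∷ rs) bs

parse : Path → State
parse = foldr step (state U leaf [] [])

step-same : ∀ o t rs bs → step o (state o t rs bs) ≡ reduce o t rs bs
step-same U t rs bs = refl
step-same D t rs bs = refl

step-opposite : ∀ o t rs bs → step (opposite o) (state o t rs bs) ≡ state o leaf (t ∷ rs) bs
step-opposite U t rs bs = refl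
step-opposite D t rs bs = refl

step-finishes : ∀ o {b bs} → IsNode b → step (opposite o) (state (opposite o) b [] bs) ≡ state o leaf [ leaf ] (b ∷ bs)
step-finishes U isNode = refl
step-finishes D isNode = refl

Valid : State → Set
Valid (state o t rs bs) = (t ≡ leaf → rs ≡ [] → bs ≡ []) × All IsNode bs

reduce-valid : ∀ o t rs bs → Valid (state o t rs bs) → Valid (reduce o t rs bs)
reduce-valid o t          (r ∷ rs) bs (_ , bs-nodes) = (λ ()) , bs-nodes
reduce-valid o leaf       []       bs (_ , bs-nodes) = (λ _ ()) , bs-nodes
reduce-valid o (node l r) []       bs (_ , bs-nodes) = (λ _ ()) , isNode ∷ bs-nodes

step-valid : ∀ x σ → Valid σ → Valid (step x σ)
step-valid U (state U t rs bs) v              = reduce-valid U t rs bs v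
step-valid D (state D t rs bs) v              = reduce-valid D t rs bs v
step-valid U (state D t rs bs) (_ , bs-nodes) = (λ _ ()) , bs-nodes
step-valid D (state U t rs bs) (_ , bs-nodes) = (λ _ ()) , bs-nodes

parse-valid : ∀ w → Valid (parse w)
parse-valid []      = (λ _ _ → refl) , []
parse-valid (x ∷ w) = step-valid x (parse w) (parse-valid w)

serialise-reduce : ∀ o t rs bs → Valid (state o t rs bs) →
                   serialise (reduce o t rs bs) ≡ o ∷ serialise (state o t rs bs)
serialise-reduce o t (r ∷ rs) bs _ =
  cong (o ∷_) (++-assoc (dyck o t) (opposite o ∷ dyck o r) _)
serialise-reduce U leaf [] bs (no-finished , _) rewrite no-finished refl refl = refl
serialise-reduce D leaf [] bs (no-finished , _) rewrite no-finished refl refl = refl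
serialise-reduce U (node l r) [] bs _ = refl
serialise-reduce D (node l r) [] bs _ = refl

serialise-step : ∀ x σ → Valid σ → serialise (step x σ) ≡ x ∷ serialise σ
serialise-step U (state U t rs bs) v = serialise-reduce U t rs bs v
serialise-step D (state D t rs bs) v = serialise-reduce D t rs bs v
serialise-step U (state D t rs bs) _ = refl
serialise-step D (state U t rs bs) _ = refl

serialise-parse : ∀ w → serialise (parse w) ≡ w
serialise-parse []      = refl
serialise-parse (x ∷ w) = trans (serialise-step x (parse w) (parse-valid w)) (cong (x ∷_) (serialise-parse w))

-- The parse of a nonempty Dyck path depends on the preceding state only through its
-- effect on the last (closing) step.
parse-dyck : ∀ o l r z {rs bs} → step (opposite o) z ≡ state o leaf (leaf ∷ rs) bs →
             foldr step z (dyck o (node l r)) ≡ state o (node l r) rs bs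
parse-dyck o l r z {rs} {bs} closes = begin
  step o (foldr step z (dyck o l ++ opposite o ∷ dyck o r))                ≡⟨ cong (step o) (foldr-++ step z (dyck o l) _) ⟩
  step o (foldr step (step (opposite o) (foldr step z (dyck o r))) (dyck o l))
    ≡⟨ cong (λ σ → step o (foldr step σ (dyck o l))) (pending r) ⟩
  step o (foldr step (state o leaf (r ∷ rs) bs) (dyck o l))                ≡⟨ cong (step o) (current l) ⟩
  step o (state o l (r ∷ rs) bs)                                           ≡⟨ step-same o l (r ∷ rs) bs ⟩
  state o (node l r) rs bs ∎
  where
  pending : ∀ r → step (opposite o) (foldr step z (dyck o r)) ≡ state o leaf (r ∷ rs) bs
  pending leaf       = closes
  pending (node a b) = trans (cong (step (opposite o)) (parse-dyck o a b z closes)) (step-opposite o _ rs bs)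
  current : ∀ l → foldr step (state o leaf (r ∷ rs) bs) (dyck o l) ≡ state o l (r ∷ rs) bs
  current leaf       = refl
  current (node a b) = parse-dyck o a b _ (step-opposite o leaf (r ∷ rs) bs)

parse-excursions : ∀ o b bs → IsNode b → All IsNode bs → parse (excursions o (b ∷ bs)) ≡ state o b [] bs
parse-excursions o (node l r) bs isNode bs-nodes =
  trans (foldr-++ step _ (dyck o (node l r)) _) (parse-dyck o l r _ (boundary o bs bs-nodes))
  where
  boundary : ∀ o bs → All IsNode bs → step (opposite o) (parse (excursions (opposite o) bs)) ≡ state o leaf [ leaf ] bs
  boundary U []       []                     = refl
  boundary D []       []                     = refl
  boundary o (c ∷ cs) (c-node ∷ cs-nodes) =
    trans (cong (step (opposite o)) (parse-excursions (opposite o) c cs c-node cs-nodes)) (step-finishes o c-node)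

afterClosings : Step → ℕ → ℤ
afterClosings U k = ℤ.- (ℤ.+ k)
afterClosings D k = ℤ.+ k

afterClosings-zero : ∀ o → afterClosings o 0 ≡ 0ℤ
afterClosings-zero U = refl
afterClosings-zero D = refl

afterClosings-suc : ∀ o k → afterClosings o (suc k) ≢ 0ℤ
afterClosings-suc U k ()
afterClosings-suc D k ()

endHeight-closing : ∀ o k p → endHeight (afterClosings o k) (opposite o ∷ p) ≡ endHeight (afterClosings o (suc k)) p
endHeight-closing U zero    p = refl
endHeight-closing U (suc k) p = refl
endHeight-closing D k       p = refl

endHeight-withPending : ∀ o k rs q →
  endHeight (afterClosings o k) (withPending o rs q) ≡ endHeight (afterClosings o (length rs + k)) q
endHeight-withPending o k []       q = refl
endHeight-withPending o k (r ∷ rs) q = begin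
  endHeight (afterClosings o k) (opposite o ∷ dyck o r ++ withPending o rs q)  ≡⟨ endHeight-closing o k _ ⟩
  endHeight (afterClosings o (suc k)) (dyck o r ++ withPending o rs q)         ≡⟨ endHeight-++ _ (dyck o r) _ ⟩
  endHeight (endHeight (afterClosings o (suc k)) (dyck o r)) (withPending o rs q)
    ≡⟨ cong (λ g → endHeight g (withPending o rs q)) (endHeight-dyck o _ r) ⟩
  endHeight (afterClosings o (suc k)) (withPending o rs q)                     ≡⟨ endHeight-withPending o (suc k) rs q ⟩
  endHeight (afterClosings o (length rs + suc k)) q                            ≡⟨ cong (λ n → endHeight (afterClosings o n) q) (+-suc (length rs) k) ⟩
  endHeight (afterClosings o (length (r ∷ rs) + k)) q ∎

endHeight-serialise : ∀ o t rs bs → endHeight 0ℤ (serialise (state o t rs bs)) ≡ afterClosings o (length rs)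
endHeight-serialise o t rs bs = begin
  endHeight 0ℤ (dyck o t ++ withPending o rs E)                   ≡⟨ endHeight-++ 0ℤ (dyck o t) _ ⟩
  endHeight (endHeight 0ℤ (dyck o t)) (withPending o rs E)         ≡⟨ cong (λ g → endHeight g (withPending o rs E)) (endHeight-dyck o 0ℤ t) ⟩
  endHeight 0ℤ (withPending o rs E)                                ≡⟨ cong (λ g → endHeight g (withPending o rs E)) (sym (afterClosings-zero o)) ⟩
  endHeight (afterClosings o 0) (withPending o rs E)               ≡⟨ endHeight-withPending o 0 rs E ⟩
  endHeight (afterClosings o (length rs + 0)) E                    ≡⟨ endHeight-excursions (opposite o) _ bs ⟩
  afterClosings o (length rs + 0)                                  ≡⟨ cong (afterClosings o) (+-identityʳ (length rs)) ⟩
  afterClosings o (length rs) ∎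
  where
  E = excursions (opposite o) bs

-- The involution

record Decomposition (w : Path) : Set where
  constructor decomposition
  field
    opening     : Step
    left right  : Tree
    later       : List Tree
    later-nodes : All IsNode later
    parse-≡     : parse w ≡ state opening (node left right) [] later

decompose : ∀ w → endHeight 0ℤ w ≡ 0ℤ → w ≢ [] → Decomposition w
decompose w closed nonempty with parse w in parse-w | parse-valid w | serialise-parse w
... | state o leaf [] bs | (no-finished , _) | serialise≡w
  rewrite no-finished refl refl = ⊥-elim (nonempty (trans (sym serialise≡w) (serialise-empty o)))
  where
  serialise-empty : ∀ o → serialise (state o leaf [] []) ≡ []
  serialise-empty U = refl
  serialise-empty D = refl
... | state o t (r ∷ rs) bs | _ | serialise≡w =
  ⊥-elim (afterClosings-suc o (length rs)
           (trans (sym (endHeight-serialise o t (r ∷ rs) bs)) (trans (cong (endHeight 0ℤ) serialise≡w) closed)))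
... | state o (node l r) [] bs | (_ , bs-nodes) | _ = decomposition o l r bs bs-nodes parse-w

-- Paths that are not closed and nonempty are fixed by ψ.
mirrorExcursions : State → Path → Path
mirrorExcursions (state o (node l r) [] bs) w = excursions (opposite o) (map mirror (node l r ∷ bs))
mirrorExcursions _                          w = w

ψ : Path → Path
ψ w = mirrorExcursions (parse w) w

module _ {w : Path} (d : Decomposition w) where
  open Decomposition d

  blocks : List Tree
  blocks = node left right ∷ later

  blocks-nodes : All IsNode blocks
  blocks-nodes = isNode ∷ later-nodes

  decomposition-path : w ≡ excursions opening blocks
  decomposition-path = trans (sym (serialise-parse w)) (cong serialise parse-≡)

  decomposition-ψ : ψ w ≡ excursions (opposite opening) (map mirror blocks)
  decomposition-ψ = cong (λ σ → mirrorExcursions σ w) parse-≡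

  ψ-closed : endHeight 0ℤ (ψ w) ≡ 0ℤ
  ψ-closed = trans (cong (endHeight 0ℤ) decomposition-ψ) (endHeight-excursions (opposite opening) 0ℤ (map mirror blocks))

  length-decomposition : length w ≡ 2 * sizes blocks
  length-decomposition = trans (cong length decomposition-path) (length-excursions opening blocks)

  complement-decomposition : ∀ {stat} → Complemented stat → stat w + stat (ψ w) ≡ sizes blocks
  complement-decomposition {stat} c = begin
    stat w + stat (ψ w)
      ≡⟨ cong₂ _+_ (cong stat decomposition-path) (cong stat decomposition-ψ) ⟩
    stat (excursions opening blocks) + stat (excursions (opposite opening) (map mirror blocks))
      ≡⟨ cong₂ _+_ (additive opening blocks blocks-nodes) (additive (opposite opening) _ (mirror-nodes blocks-nodes)) ⟩
    blockwise stat opening blocks + blockwise stat (opposite opening) (map mirror blocks)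
      ≡⟨ blockwise-mirror c opening blocks ⟩
    sizes blocks ∎
    where open Complemented c

  ψ-decomposition : Decomposition (ψ w)
  ψ-decomposition = decomposition (opposite opening) (mirror right) (mirror left) (map mirror later)
    (mirror-nodes later-nodes)
    (trans (cong parse decomposition-ψ) (parse-excursions (opposite opening) _ _ isNode (mirror-nodes later-nodes)))

ψ-involutive-decomposition : ∀ {w} → Decomposition w → ψ (ψ w) ≡ w
ψ-involutive-decomposition {w} d = begin
  ψ (ψ w)                                                                   ≡⟨ decomposition-ψ (ψ-decomposition d) ⟩
  excursions (opposite (opposite opening)) (map mirror (map mirror (blocks d)))
    ≡⟨ cong₂ excursions (opposite-involutive opening) (map-mirror-involutive (blocks d)) ⟩
  excursions opening (blocks d)                                             ≡⟨ sym (decomposition-path d) ⟩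
  w ∎
  where open Decomposition d

decomposition-or-fixed : ∀ w → Decomposition w ⊎ ψ w ≡ w
decomposition-or-fixed w with parse w in parse-w | parse-valid w
... | state o (node l r) [] bs | (_ , bs-nodes) = inj₁ (decomposition o l r bs bs-nodes parse-w)
... | state o leaf rs bs            | _ = inj₂ refl
... | state o (node l r) (_ ∷ _) bs | _ = inj₂ refl

ψ-involutive : ∀ w → ψ (ψ w) ≡ w
ψ-involutive w with decomposition-or-fixed w
... | inj₁ d     = ψ-involutive-decomposition d
... | inj₂ fixed = trans (cong ψ fixed) fixed

length-ψ : ∀ w → length (ψ w) ≡ length w
length-ψ w with decomposition-or-fixed w
... | inj₁ d     = begin
  length (ψ w)                                                          ≡⟨ cong length (decomposition-ψ d) ⟩
  length (excursions (opposite (opening d)) (map mirror (blocks d)))    ≡⟨ length-excursions _ (map mirror (blocks d)) ⟩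
  2 * sizes (map mirror (blocks d))                                     ≡⟨ cong (2 *_) (sizes-mirror (blocks d)) ⟩
  2 * sizes (blocks d)                                                  ≡⟨ sym (length-decomposition d) ⟩
  length w ∎
  where open Decomposition
... | inj₂ fixed = cong length fixed

Flawed : ℕ → ℕ → Path → Set
Flawed m k w = (endHeight 0ℤ w ≡ 0ℤ) × (underUps 0ℤ w ≡ m) × (valleys w ≡ k)

flawed? : ∀ m k → Decidable (Flawed m k)
flawed? m k w = (endHeight 0ℤ w ℤP.≟ 0ℤ) ×-dec (underUps 0ℤ w ℕP.≟ m) ×-dec (valleys w ℕP.≟ k)

ψ-flawed : ∀ n {m k w} → w ∈ words (2 * suc n) → Flawed m k w → Flawed (suc n ∸ m) (suc n ∸ k) (ψ w)
ψ-flawed n {w = w} w∈ (closed , refl , refl) =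
  ψ-closed d , complement-∸ underUps-complemented , complement-∸ valleys-complemented
  where
  length-w : length w ≡ 2 * suc n
  length-w = ∈-words⁻ (2 * suc n) w∈
  d : Decomposition w
  d = decompose w closed (λ { refl → ℕP.0≢1+n length-w })
  sizes≡ : sizes (blocks d) ≡ suc n
  sizes≡ = *-cancelˡ-≡ _ _ 2 (trans (sym (length-decomposition d)) length-w)
  complement-∸ : ∀ {stat} → Complemented stat → stat (ψ w) ≡ suc n ∸ stat w
  complement-∸ {stat} c = trans (sym (m+n∸m≡n (stat w) (stat (ψ w))))
                              (cong (_∸ stat w) (trans (complement-decomposition d c) sizes≡))

ψ-∈-words : ∀ {ℓ w} → w ∈ words ℓ → ψ w ∈ words ℓ
ψ-∈-words {ℓ} {w} w∈ = subst (λ n → ψ w ∈ words n) (trans (length-ψ w) (∈-words⁻ ℓ w∈)) (∈-words⁺ (ψ w))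

corollary2p3 : (n m k : ℕ) → 1 ≤ n → m ≤ n → k ≤ n → v n m k ≡ v n (n ∸ m) (n ∸ k)
corollary2p3 (suc n) m k (s≤s _) m≤n k≤n =
  length-filter-involution (flawed? m k) (flawed? (suc n ∸ m) (suc n ∸ k)) (words (2 * suc n)) ψ
    (words-unique (2 * suc n)) ψ-involutive (ψ-∈-words {2 * suc n}) (ψ-flawed n) back
  where
  back : ∀ {w} → w ∈ words (2 * suc n) → Flawed (suc n ∸ m) (suc n ∸ k) w → Flawed m k (ψ w)
  back {w} w∈ flawed = subst₂ (λ m′ k′ → Flawed m′ k′ (ψ w)) (m∸[m∸n]≡n m≤n) (m∸[m∸n]≡n k≤n) (ψ-flawed n w∈ flawed)
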